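{- Let $k\in\mathbb{N}$ and let $S$ be either $\langle 6k+5,6k+7,6k+11\rangle$ or $\langle 6k+7,6k+11,6k+13\rangle$. Then $\mathrm{e}(S)=3$ and $\mathrm{t}(S)=2$.
   Context: $\mathbb{N}=\{0,1,2,\dots\}$. For $X\subseteq\mathbb{N}$, $\langle X\rangle$ denotes the submonoid of $(\mathbb{N},+)$ generated by $X$ (all finite $\mathbb{N}$-linear combinations of elements of $X$). A numerical semigroup is a submonoid $S$ of $(\mathbb{N},+)$ with $\mathbb{N}\setminus S$ finite. Every numerical semigroup has a unique minimal system of generators; its cardinality is the embedding dimension $\mathrm{e}(S)$. An integer $x$ is a pseudo-Frobenius number of $S$ if $x\in\mathbb{Z}\setminus S$ and $x+s\in S$ for all $s\in S\setminus\{0\}$; the type $\mathrm{t}(S)$ is the number of pseudo-Frobenius numbers of $S$. -}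

module Defs where

open import Data.Nat using (ℕ; zero; suc; _+_; _*_)
open import Data.Integer using (ℤ; +_) renaming (_+_ to _+ℤ_)
open import Data.Fin using (Fin)
open import Data.Product using (Σ; ∃; _×_; _,_)
open import Data.Sum using (_⊎_)
open import Relation.Nullary using (¬_)
open import Relation.Binary.PropositionalEquality using (_≡_; _≢_)
open import Function.Definitions using (Injective)
open import Function.Bundles using (_⇔_)
open import Level using (0ℓ)
open import Data.List using (List)
open import Data.List.Membership.Propositional using (_∈_)

Subset : Set₁
Subset = ℕ → Set

data ⟨_⟩ (X : Subset) : ℕ → Set where
  gen-zero : ⟨ X ⟩ 0
  gen-add  : ∀ {g n} → X g → ⟨ X ⟩ n → ⟨ X ⟩ (g + n)

elems : List ℕ → Subset
elems gs x = x ∈ gs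

⟨_⟩ₗ : List ℕ → Subset
⟨ gs ⟩ₗ = ⟨ elems gs ⟩

_≐_ : Subset → Subset → Set
A ≐ B = ∀ n → (A n ⇔ B n)

Generates : Subset → Subset → Set
Generates G S = ⟨ G ⟩ ≐ S

_∖｛_｝ : Subset → ℕ → Subset
(G ∖｛ g ｝) x = G x × x ≢ g

-- G is a minimal system of generators of S: it generates S and no proper
-- subset of G generates S (equivalently, no G ∖ {g} with g ∈ G does,
-- since ⟨_⟩ is monotone).
MinimalGenerators : Subset → Subset → Set
MinimalGenerators G S = Generates G S × (∀ g → G g → ¬ Generates (G ∖｛ g ｝) S)

HasCardinality : {A : Set} → (A → Set) → ℕ → Set
HasCardinality {A} P n =
  Σ (Fin n → A) λ f → Injective _≡_ _≡_ f × (∀ x → (P x ⇔ ∃ λ i → f i ≡ x))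

EmbeddingDimensionIs : Subset → ℕ → Set₁
EmbeddingDimensionIs S n = Σ Subset λ G → MinimalGenerators G S × HasCardinality G n

_∈ℤ_ : ℤ → Subset → Set
x ∈ℤ S = ∃ λ n → x ≡ + n × S n

PseudoFrobenius : Subset → ℤ → Set
PseudoFrobenius S x = ¬ (x ∈ℤ S) × (∀ s → S s → s ≢ 0 → (x +ℤ + s) ∈ℤ S)

TypeIs : Subset → ℕ → Set
TypeIs S n = HasCardinality (PseudoFrobenius S) n

{-# OPTIONS --safe #-}
-- Let a be the least generator (6k + 5, resp. 6k + 7); it is odd and the other generators are
-- a + 2δ with δ ∈ {1, 3}, resp. δ ∈ {2, 3}. Since a is odd, every element of S is uniquely n·a + 2m
-- with m < a, and it lies in S iff n ≥ level m for an explicit function level, so the Apéry set of S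
-- with respect to a is { level m · a + 2m | m < a }. The pseudo-Frobenius numbers are w − a for the
-- Apéry elements w that are maximal for ≤_S, and maximality only has to be tested by adding the
-- generators. Locating m near a and modulo 3 leaves exactly two maximal elements in each family.
-- The embedding dimension is 3 because the differences 2, 4, 6 of the generators are small even
-- numbers, which lie outside S.
module Submission where

open import Defs
open import Data.Nat
open import Data.Nat.Properties
open import Data.Nat.Tactic.RingSolver using (solve)
open import Data.Integer as ℤ using (ℤ) renaming (+_ to pos)
import Data.Integer.Properties as ℤ
open import Algebra.Properties.AbelianGroup ℤ.+-0-abelianGroup using (∙-cancelʳ)
open import Data.Fin using (zero; suc)
open import Data.List using (List; _∷_; []; length; lookup)
import Data.List.Relation.Unary.All as All
import Data.List.Relation.Unary.AllPairs as AllPairs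
open import Data.List.Relation.Unary.Any using (here; there; index)
open import Data.List.Relation.Unary.Any.Properties using (lookup-index)
open import Data.List.Relation.Unary.Unique.Propositional using (Unique)
open import Data.List.Membership.Propositional using (_∈_)
open import Data.List.Membership.Propositional.Properties using (∈-lookup)
open import Data.Product using (∃; _×_; _,_; proj₁; proj₂)
open import Data.Sum using (_⊎_; inj₁; inj₂)
open import Data.Empty using (⊥; ⊥-elim)
open import Function.Base using (_∘_)
open import Function.Bundles using (_⇔_; mk⇔; Equivalence)
import Function.Properties.Equivalence as ⇔
open import Function.Definitions using (Injective)
open import Relation.Nullary using (¬_; yes; no; contradiction)
open import Relation.Binary.PropositionalEquality

⟨⟩-+ : ∀ {X u v} → ⟨ X ⟩ u → ⟨ X ⟩ v → ⟨ X ⟩ (u + v)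
⟨⟩-+ gen-zero q = q
⟨⟩-+ {v = v} (gen-add {g} {n} x p) q = subst ⟨ _ ⟩ (sym (+-assoc g n v)) (gen-add x (⟨⟩-+ p q))

⟨⟩-generator : ∀ {X g} → X g → ⟨ X ⟩ g
⟨⟩-generator {g = g} x = subst ⟨ _ ⟩ (+-identityʳ g) (gen-add x gen-zero)

-- AllPairs._∷_ stays local: an overloaded _∷_ leaves the variable list given to solve ambiguous.
module _ where
  open AllPairs using (_∷_)

  lookup-injective : ∀ {A : Set} {xs : List A} → Unique xs → Injective _≡_ _≡_ (lookup xs)
  lookup-injective (_    ∷ _) {zero}  {zero}  _  = refl
  lookup-injective (x≢xs ∷ _) {zero}  {suc j} eq = contradiction eq (All.lookup x≢xs (∈-lookup j))
  lookup-injective (x≢xs ∷ _) {suc i} {zero}  eq = contradiction (sym eq) (All.lookup x≢xs (∈-lookup i))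
  lookup-injective (_    ∷ u) {suc i} {suc j} eq = cong suc (lookup-injective u eq)

  ∈-hasCardinality : ∀ {A : Set} {xs : List A} → Unique xs → HasCardinality (_∈ xs) (length xs)
  ∈-hasCardinality {xs = xs} u =
    lookup xs , lookup-injective u ,
    λ x → mk⇔ (λ x∈xs → index x∈xs , sym (lookup-index x∈xs)) λ { (i , refl) → ∈-lookup i }

hasCardinality-resp : ∀ {A : Set} {P Q : A → Set} {n} → (∀ x → P x ⇔ Q x) →
                      HasCardinality P n → HasCardinality Q n
hasCardinality-resp P⇔Q (f , f-injective , P⇔image) =
  f , f-injective , λ x → ⇔.trans (⇔.sym (P⇔Q x)) (P⇔image x)

⟨⟩-mono : ∀ {X Y : Subset} → (∀ {x} → X x → Y x) → ∀ {v} → ⟨ X ⟩ v → ⟨ Y ⟩ v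
⟨⟩-mono X⊆Y gen-zero          = gen-zero
⟨⟩-mono X⊆Y (gen-add x∈X v∈X) = gen-add (X⊆Y x∈X) (⟨⟩-mono X⊆Y v∈X)

module _ {g₁ g₂ g₃ : ℕ} (0<g₁ : 0 < g₁) (g₁<g₂ : g₁ < g₂) (g₂<g₃ : g₂ < g₃) where

  private
    L : List ℕ
    L = g₁ ∷ g₂ ∷ g₃ ∷ []

  embeddingDimension≡3 : ¬ ⟨ L ⟩ₗ (g₂ ∸ g₁) → ¬ ⟨ L ⟩ₗ (g₃ ∸ g₁) → ¬ ⟨ L ⟩ₗ (g₃ ∸ g₂) →
                         EmbeddingDimensionIs ⟨ L ⟩ₗ 3
  embeddingDimension≡3 g₂∸g₁∉S g₃∸g₁∉S g₃∸g₂∉S =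
    elems L , ((λ _ → ⇔.refl) , minimal) , ∈-hasCardinality distinct
    where
    descending : ∀ {g h r} → g < h → h + r ≡ g → ⊥
    descending {g} {h} {r} g<h refl = m+n≮m h r g<h

    difference : ∀ {g h r} → h + r ≡ g → ¬ ⟨ L ⟩ₗ (g ∸ h) → ¬ ⟨ L ⟩ₗ r
    difference {h = h} {r} refl g∸h∉S r∈S = g∸h∉S (subst ⟨ L ⟩ₗ (sym (m+n∸m≡n h r)) r∈S)

    g₁<g₃ : g₁ < g₃
    g₁<g₃ = <-trans g₁<g₂ g₂<g₃

    sum-of-other : ∀ {g h r} → g ∈ L → h ∈ L → h ≢ g → h + r ≡ g → ¬ ⟨ L ⟩ₗ r
    sum-of-other (here refl)                 (here refl)                 h≢g = contradiction refl h≢g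
    sum-of-other (here refl)                 (there (here refl))         _   = ⊥-elim ∘ descending g₁<g₂
    sum-of-other (here refl)                 (there (there (here refl))) _   = ⊥-elim ∘ descending g₁<g₃
    sum-of-other (there (here refl))         (here refl)                 _   = λ eq → difference eq g₂∸g₁∉S
    sum-of-other (there (here refl))         (there (here refl))         h≢g = contradiction refl h≢g
    sum-of-other (there (here refl))         (there (there (here refl))) _   = ⊥-elim ∘ descending g₂<g₃
    sum-of-other (there (there (here refl))) (here refl)                 _   = λ eq → difference eq g₃∸g₁∉S
    sum-of-other (there (there (here refl))) (there (here refl))         _   = λ eq → difference eq g₃∸g₂∉S
    sum-of-other (there (there (here refl))) (there (there (here refl))) h≢g = contradiction refl h≢g

    irreducible : ∀ {g v} → g ∈ L → ⟨ elems L ∖｛ g ｝ ⟩ v → v ≡ g → ⊥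
    irreducible g∈L gen-zero refl = n≮n 0 (<-≤-trans 0<g₁ (nonzero g∈L))
      where
      nonzero : ∀ {g} → g ∈ L → g₁ ≤ g
      nonzero (here refl)                 = ≤-refl
      nonzero (there (here refl))         = <⇒≤ g₁<g₂
      nonzero (there (there (here refl))) = <⇒≤ g₁<g₃
    irreducible g∈L (gen-add (h∈L , h≢g) r∈S) h+r≡g =
      sum-of-other g∈L h∈L h≢g h+r≡g (⟨⟩-mono proj₁ r∈S)

    minimal : ∀ g → elems L g → ¬ Generates (elems L ∖｛ g ｝) ⟨ L ⟩ₗ
    minimal g g∈L generates = irreducible g∈L (Equivalence.from (generates g) (⟨⟩-generator g∈L)) refl

    distinct : Unique L
    distinct = (<⇒≢ g₁<g₂ ∷ <⇒≢ g₁<g₃ ∷ []) ∷ (<⇒≢ g₂<g₃ ∷ []) ∷ [] ∷ []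
      where
      open All using (_∷_; [])
      open AllPairs using (_∷_; [])

+-pos-shift : ∀ {x N} g d → x ℤ.+ pos g ≡ pos N → x ℤ.+ pos (g + d) ≡ pos (N + d)
+-pos-shift {x} {N} g d x+g≡N = begin
  x ℤ.+ pos (g + d)       ≡⟨ cong (λ y → x ℤ.+ y) (ℤ.pos-+ g d) ⟩
  x ℤ.+ (pos g ℤ.+ pos d)   ≡⟨ sym (ℤ.+-assoc x (pos g) (pos d)) ⟩
  x ℤ.+ pos g ℤ.+ pos d     ≡⟨ cong (λ y → y ℤ.+ pos d) x+g≡N ⟩
  pos N ℤ.+ pos d           ≡⟨ sym (ℤ.pos-+ N d) ⟩
  pos (N + d)             ∎
  where open ≡-Reasoning

+-pos-cancel : ∀ {x N} g → x ℤ.+ pos g ≡ pos (N + g) → x ≡ pos N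
+-pos-cancel {x} {N} g eq = ∙-cancelʳ (pos g) x (pos N) (trans eq (ℤ.pos-+ N g))

pseudoFrobenius⇔ : ∀ {L} → (∀ {g} → g ∈ L → g ≢ 0) → ∀ x →
  PseudoFrobenius ⟨ L ⟩ₗ x ⇔ (¬ x ∈ℤ ⟨ L ⟩ₗ × (∀ {g} → g ∈ L → (x ℤ.+ pos g) ∈ℤ ⟨ L ⟩ₗ))
pseudoFrobenius⇔ {L} nonzero x = mk⇔
  (λ (x∉S , x+S⊆S) → x∉S , λ g∈L → x+S⊆S _ (⟨⟩-generator g∈L) (nonzero g∈L))
  (λ (x∉S , x+L⊆S) → x∉S , closed x+L⊆S)
  where
  closed : (∀ {g} → g ∈ L → (x ℤ.+ pos g) ∈ℤ ⟨ L ⟩ₗ) →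
           ∀ s → ⟨ L ⟩ₗ s → s ≢ 0 → (x ℤ.+ pos s) ∈ℤ ⟨ L ⟩ₗ
  closed _ _ gen-zero s≢0 = contradiction refl s≢0
  closed x+L⊆S _ (gen-add {g} {r} g∈L r∈S) _ with x+L⊆S g∈L
  ... | N , x+g≡N , N∈S = N + r , +-pos-shift {x} g r x+g≡N , ⟨⟩-+ N∈S r∈S

overflow< : ∀ {a δ m r} → m < a → δ + m ≡ a + r → r < δ
overflow< {a} {δ} {m} {r} m<a δ+m≡a+r =
  +-cancelˡ-< a r δ (subst (_< a + δ) δ+m≡a+r (subst (δ + m <_) (+-comm δ a) (+-monoʳ-< δ m<a)))

-- Adding a + 2δ to n·a + 2m gives (1 + n)·a + 2(δ + m), or (3 + n)·a + 2r when δ + m = a + r;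
-- these bounds keep n ≥ level m true in both cases.
record Shift (a : ℕ) (level : ℕ → ℕ) (δ : ℕ) : Set where
  field
    δ<a  : δ < a
    step : ∀ m → level (δ + m) ≤ suc (level m)
    wrap : ∀ {m r} → m < a → δ + m ≡ a + r → level r ≤ 3 + level m

-- level m is the least n with n·a + 2m ∈ S, so level m · a + 2m is the Apéry element of residue 2m.
module Apéry
  (a h : ℕ) (a≡1+2h : a ≡ suc (2 * h))
  (g₂ g₃ δ₂ δ₃ : ℕ) (g₂≡ : g₂ ≡ a + 2 * δ₂) (g₃≡ : g₃ ≡ a + 2 * δ₃)
  (level : ℕ → ℕ) (level-0 : level 0 ≡ 0)
  (shift₂ : Shift a level δ₂) (shift₃ : Shift a level δ₃)
  (apery∈S : ∀ {m} → m < a → ⟨ a ∷ g₂ ∷ g₃ ∷ [] ⟩ₗ (level m * a + 2 * m))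
  where

  L : List ℕ
  L = a ∷ g₂ ∷ g₃ ∷ []

  S : Subset
  S = ⟨ L ⟩ₗ

  a>0 : 0 < a
  a>0 = subst (0 <_) (sym a≡1+2h) z<s

  private
    coefficient-≤ : ∀ {n m n' m'} → n ≤ n' → m < a → n * a + 2 * m ≡ n' * a + 2 * m' → n ≡ n'
    coefficient-≤ {n} {m} {n'} {m'} n≤n' m<a eq with m≤n⇒∃[o]m+o≡n n≤n'
    ... | c , refl = sym (trans (cong (n +_) (c≡0 c 2m≡ca+2m')) (+-identityʳ n))
      where
      split : (n + c) * a + 2 * m' ≡ n * a + (c * a + 2 * m')
      split = solve (n ∷ c ∷ a ∷ m' ∷ [])
      2m≡ca+2m' : 2 * m ≡ c * a + 2 * m'
      2m≡ca+2m' = +-cancelˡ-≡ (n * a) (2 * m) (c * a + 2 * m') (trans eq split)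
      c≡0 : ∀ c → 2 * m ≡ c * a + 2 * m' → c ≡ 0
      c≡0 zero          _         = refl
      c≡0 (suc zero)    2m≡a+2m'  = contradiction (trans 2m≡a+2m' odd) (even≢odd m (h + m'))
        where
        odd : 1 * a + 2 * m' ≡ suc (2 * (h + m'))
        odd rewrite a≡1+2h = solve (h ∷ m' ∷ [])
      c≡0 (suc (suc c)) 2m≡[2+c]a+2m' = contradiction (*-cancelˡ-≤ 2 2a≤2m) (<⇒≱ m<a)
        where
        2a≤2m : 2 * a ≤ 2 * m
        2a≤2m = subst (2 * a ≤_) (sym (trans 2m≡[2+c]a+2m' regroup)) (m≤m+n (2 * a) (c * a + 2 * m'))
          where
          regroup : suc (suc c) * a + 2 * m' ≡ 2 * a + (c * a + 2 * m')
          regroup = solve (c ∷ a ∷ m' ∷ [])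

  coordinates-injective : ∀ {n m n' m'} → m < a → m' < a → n * a + 2 * m ≡ n' * a + 2 * m' →
                          n ≡ n' × m ≡ m'
  coordinates-injective {n} {m} {n'} {m'} m<a m'<a eq = n≡n' , m≡m'
    where
    n≡n' : n ≡ n'
    n≡n' with ≤-total n n'
    ... | inj₁ n≤n' = coefficient-≤ {m' = m'} n≤n' m<a eq
    ... | inj₂ n'≤n = sym (coefficient-≤ {m' = m} n'≤n m'<a (sym eq))
    m≡m' : m ≡ m'
    m≡m' = *-cancelˡ-≡ m m' 2
             (+-cancelˡ-≡ (n * a) (2 * m) (2 * m') (trans eq (cong (λ n → n * a + 2 * m') (sym n≡n'))))

  data Canonical (N : ℕ) : Set where
    coords : ∀ n m → m < a → level m ≤ n → N ≡ n * a + 2 * m → Canonical N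

  canonical-+a : ∀ {N} → Canonical N → Canonical (a + N)
  canonical-+a (coords n m m<a level≤n refl) =
    coords (suc n) m m<a (m≤n⇒m≤1+n level≤n) (sym (+-assoc a (n * a) (2 * m)))

  canonical-+shift : ∀ {δ N} → Shift a level δ → Canonical N → Canonical (a + 2 * δ + N)
  canonical-+shift {δ} shift (coords n m m<a level≤n refl) with δ + m <? a
  ... | yes δ+m<a = coords (suc n) (δ + m) δ+m<a (≤-trans (step m) (s≤s level≤n)) (solve (a ∷ δ ∷ n ∷ m ∷ []))
    where open Shift shift
  ... | no δ+m≮a with m≤n⇒∃[o]m+o≡n (≮⇒≥ δ+m≮a)
  ...   | r , a+r≡δ+m =
    coords (3 + n) r (<-trans (overflow< m<a (sym a+r≡δ+m)) δ<a)
           (≤-trans (wrap m<a (sym a+r≡δ+m)) (+-monoʳ-≤ 3 level≤n)) wrapped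
    where
    open Shift shift
    wrapped : a + 2 * δ + (n * a + 2 * m) ≡ (3 + n) * a + 2 * r
    wrapped = begin
      a + 2 * δ + (n * a + 2 * m)  ≡⟨ solve (a ∷ δ ∷ n ∷ m ∷ []) ⟩
      a + n * a + 2 * (δ + m)      ≡⟨ cong (λ x → a + n * a + 2 * x) (sym a+r≡δ+m) ⟩
      a + n * a + 2 * (a + r)      ≡⟨ solve (a ∷ n ∷ r ∷ []) ⟩
      (3 + n) * a + 2 * r          ∎
      where open ≡-Reasoning

  canonical : ∀ {N} → S N → Canonical N
  canonical gen-zero = coords 0 0 a>0 (≤-reflexive level-0) refl
  canonical (gen-add (here refl) N∈S) = canonical-+a (canonical N∈S)
  canonical (gen-add (there (here refl)) N∈S) =
    subst Canonical (cong (_+ _) (sym g₂≡)) (canonical-+shift shift₂ (canonical N∈S))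
  canonical (gen-add (there (there (here refl))) N∈S) =
    subst Canonical (cong (_+ _) (sym g₃≡)) (canonical-+shift shift₃ (canonical N∈S))

  sound : ∀ {n m} → m < a → level m ≤ n → S (n * a + 2 * m)
  sound {n} {m} m<a level≤n with m≤n⇒∃[o]m+o≡n level≤n
  ... | j , refl = subst S (regroup (level m)) (a-multiple j (apery∈S m<a))
    where
    regroup : ∀ l → j * a + (l * a + 2 * m) ≡ (l + j) * a + 2 * m
    regroup l = solve (j ∷ a ∷ l ∷ m ∷ [])
    a-multiple : ∀ j {N} → S N → S (j * a + N)
    a-multiple zero    N∈S = N∈S
    a-multiple (suc j) {N} N∈S = subst S (sym (+-assoc a (j * a) N)) (gen-add (here refl) (a-multiple j N∈S))

  complete : ∀ {n m} → m < a → S (n * a + 2 * m) → level m ≤ n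
  complete {n} {m} m<a N∈S with canonical N∈S
  ... | coords n' m' m'<a level≤n' eq with coordinates-injective {n} {m} {n'} {m'} m<a m'<a eq
  ...   | refl , refl = level≤n'

  -- For m = a + r, n·a + 2m = (2 + n)·a + 2r.
  data Fits (n m : ℕ) : Set where
    below : m < a → level m ≤ n → Fits n m
    above : ∀ r → r < a → m ≡ a + r → level r ≤ 2 + n → Fits n m

  private
    unwrap : ∀ n r → (2 + n) * a + 2 * r ≡ n * a + 2 * (a + r)
    unwrap n r = solve (n ∷ a ∷ r ∷ [])

  fits-sound : ∀ {n m} → Fits n m → S (n * a + 2 * m)
  fits-sound (below m<a level≤n) = sound m<a level≤n
  fits-sound {n} (above r r<a refl level≤2+n) = subst S (unwrap n r) (sound r<a level≤2+n)

  fits-complete : ∀ {n m} → m < a + a → S (n * a + 2 * m) → Fits n m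
  fits-complete {n} {m} m<2a N∈S with m <? a
  ... | yes m<a = below m<a (complete m<a N∈S)
  ... | no m≮a with m≤n⇒∃[o]m+o≡n (≮⇒≥ m≮a)
  ...   | r , refl = above r r<a refl (complete r<a (subst S (sym (unwrap n r)) N∈S))
    where
    r<a : r < a
    r<a = +-cancelˡ-< a r a m<2a

  fits-below : ∀ {n m} → m < a → Fits n m → level m ≤ n
  fits-below _   (below _ level≤n)      = level≤n
  fits-below m<a (above r _ refl _)     = contradiction m<a (m+n≮m a r)

  fits-above : ∀ {n r} → Fits n (a + r) → level r ≤ 2 + n
  fits-above (below a+r<a _)                = contradiction a+r<a (m+n≮m a _)
  fits-above {n} (above r' _ a+r≡a+r' level≤2+n) =
    subst (λ r → level r ≤ 2 + n) (sym (+-cancelˡ-≡ a _ r' a+r≡a+r')) level≤2+n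

  aperyElement : ℕ → ℕ
  aperyElement m = level m * a + 2 * m

  -- aperyElement m − a + g ∈ S for every generator g, i.e. aperyElement m is ≤_S-maximal in the Apéry set.
  Maximal : ℕ → Set
  Maximal m = m < a × Fits (level m) (δ₂ + m) × Fits (level m) (δ₃ + m)

  private
    nonzero : ∀ {g} → g ∈ L → g ≢ 0
    nonzero (here refl)                 = <⇒≢ a>0 ∘ sym
    nonzero (there (here refl))         = <⇒≢ (<-≤-trans a>0 (subst (a ≤_) (sym g₂≡) (m≤m+n a _))) ∘ sym
    nonzero (there (there (here refl))) = <⇒≢ (<-≤-trans a>0 (subst (a ≤_) (sym g₃≡) (m≤m+n a _))) ∘ sym

    fits-after : ∀ {x n m δ g} → g ≡ a + 2 * δ → δ < a → m < a →
                 x ℤ.+ pos a ≡ pos (n * a + 2 * m) → (x ℤ.+ pos g) ∈ℤ S → Fits n (δ + m)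
    fits-after {x} {n} {m} {δ} refl δ<a m<a x+a≡ (N , x+g≡N , N∈S) =
      fits-complete (+-mono-< δ<a m<a) (subst S N≡ N∈S)
      where
      N≡ : N ≡ n * a + 2 * (δ + m)
      N≡ = trans (ℤ.+-injective (trans (sym x+g≡N) (+-pos-shift {x} a (2 * δ) x+a≡)))
                 (solve (n ∷ a ∷ m ∷ δ ∷ []))

    least-coefficient : ∀ {x n m} → ¬ x ∈ℤ S → x ℤ.+ pos a ≡ pos (n * a + 2 * m) → m < a → level m ≤ n →
                        n ≡ level m
    least-coefficient {n = zero}          _   _      _   level≤0 = sym (n≤0⇒n≡0 level≤0)
    least-coefficient {x} {suc n} {m} x∉S x+a≡ m<a level≤1+n with level m ≤? n
    ... | yes level≤n = contradiction (n * a + 2 * m , x≡ , sound m<a level≤n) x∉S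
      where
      x≡ : x ≡ pos (n * a + 2 * m)
      x≡ = +-pos-cancel a (trans x+a≡ (cong pos (solve (n ∷ a ∷ m ∷ []))))
    ... | no  level≰n = ≤-antisym (≰⇒> level≰n) level≤1+n

  pseudoFrobenius-maximal : ∀ {x} → PseudoFrobenius S x →
                            ∃ λ m → Maximal m × x ℤ.+ pos a ≡ pos (aperyElement m)
  pseudoFrobenius-maximal {x} pf with Equivalence.to (pseudoFrobenius⇔ nonzero x) pf
  ... | x∉S , x+L⊆S with x+L⊆S (here refl)
  ... | N , x+a≡N , N∈S with canonical N∈S
  ... | coords n m m<a level≤n refl with least-coefficient x∉S x+a≡N m<a level≤n
  ... | refl = m , (m<a , fits-after {x} g₂≡ (Shift.δ<a shift₂) m<a x+a≡N (x+L⊆S (there (here refl)))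
                        , fits-after {x} g₃≡ (Shift.δ<a shift₃) m<a x+a≡N (x+L⊆S (there (there (here refl)))))
                 , x+a≡N

  private
    aperyElement-pred : ∀ {m n} → level m ≡ suc n → aperyElement m ≡ n * a + 2 * m + a
    aperyElement-pred {m} {n} level≡1+n rewrite level≡1+n = solve (n ∷ a ∷ m ∷ [])

  maximal-pseudoFrobenius : ∀ {m n} → Maximal m → level m ≡ suc n → PseudoFrobenius S (pos (n * a + 2 * m))
  maximal-pseudoFrobenius {m} {n} (m<a , fits₂ , fits₃) level≡1+n =
    Equivalence.from (pseudoFrobenius⇔ nonzero _) (p∉S , p+L⊆S)
    where
    p : ℕ
    p = n * a + 2 * m

    p∉S : ¬ pos p ∈ℤ S
    p∉S (N , p≡N , N∈S) =
      1+n≰n (subst (_≤ n) level≡1+n (complete m<a (subst S (sym (ℤ.+-injective p≡N)) N∈S)))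

    p+gap∈S : ∀ {g δ} → g ≡ a + 2 * δ → Fits (level m) (δ + m) → (pos p ℤ.+ pos g) ∈ℤ S
    p+gap∈S {g} {δ} refl fits =
      p + g , sym (ℤ.pos-+ p g) , subst S regroup (fits-sound (subst (λ l → Fits l (δ + m)) level≡1+n fits))
      where
      regroup : suc n * a + 2 * (δ + m) ≡ n * a + 2 * m + (a + 2 * δ)
      regroup = solve (n ∷ a ∷ δ ∷ m ∷ [])

    p+L⊆S : ∀ {g} → g ∈ L → (pos p ℤ.+ pos g) ∈ℤ S
    p+L⊆S (here refl) =
      p + a , sym (ℤ.pos-+ p a) , subst S (aperyElement-pred level≡1+n) (sound m<a (≤-reflexive refl))
    p+L⊆S (there (here refl))         = p+gap∈S g₂≡ fits₂
    p+L⊆S (there (there (here refl))) = p+gap∈S g₃≡ fits₃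

  type≡2 : ∀ {m₁ m₂ n₁ n₂} → Maximal m₁ → Maximal m₂ → m₁ ≢ m₂ → level m₁ ≡ suc n₁ → level m₂ ≡ suc n₂ →
           (∀ {m} → Maximal m → m ≡ m₁ ⊎ m ≡ m₂) → TypeIs S 2
  type≡2 {m₁} {m₂} {n₁} {n₂} max₁ max₂ m₁≢m₂ level₁ level₂ maximal⇒ =
    hasCardinality-resp PF⇔ (∈-hasCardinality distinct)
    where
    p₁ p₂ : ℕ
    p₁ = n₁ * a + 2 * m₁
    p₂ = n₂ * a + 2 * m₂

    PF⇔ : ∀ x → x ∈ pos p₁ ∷ pos p₂ ∷ [] ⇔ PseudoFrobenius S x
    PF⇔ x = mk⇔ to from
      where
      to : x ∈ pos p₁ ∷ pos p₂ ∷ [] → PseudoFrobenius S x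
      to (here refl)         = maximal-pseudoFrobenius max₁ level₁
      to (there (here refl)) = maximal-pseudoFrobenius max₂ level₂
      from : PseudoFrobenius S x → x ∈ pos p₁ ∷ pos p₂ ∷ []
      from pf with pseudoFrobenius-maximal pf
      ... | m , max , x+a≡w with maximal⇒ max
      ... | inj₁ refl = here (+-pos-cancel a (trans x+a≡w (cong pos (aperyElement-pred level₁))))
      ... | inj₂ refl = there (here (+-pos-cancel a (trans x+a≡w (cong pos (aperyElement-pred level₂)))))

    distinct : Unique (pos p₁ ∷ pos p₂ ∷ [])
    distinct = (p₁≢p₂ ∷ []) ∷ [] ∷ []
      where
      open All using (_∷_; [])
      open AllPairs using (_∷_; [])
      p₁≢p₂ : pos p₁ ≢ pos p₂
      p₁≢p₂ eq =
        m₁≢m₂ (proj₂ (coordinates-injective {n₁} {m₁} {n₂} {m₂} (proj₁ max₁) (proj₁ max₂) (ℤ.+-injective eq)))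

  small-even∉S : ∀ {M} → M < a → level M ≢ 0 → ¬ S (2 * M)
  small-even∉S M<a level≢0 2M∈S = level≢0 (n≤0⇒n≡0 (complete {0} M<a 2M∈S))

  embeddingDimension : 0 < δ₂ → δ₂ < δ₃ → level δ₂ ≢ 0 → level δ₃ ≢ 0 → level (δ₃ ∸ δ₂) ≢ 0 →
                       EmbeddingDimensionIs S 3
  embeddingDimension 0<δ₂ δ₂<δ₃ level₂≢0 level₃≢0 level₃₂≢0 =
    embeddingDimension≡3 a>0 a<g₂ g₂<g₃
      (subst (¬_ ∘ S) (sym g₂∸a≡) (small-even∉S δ₂<a level₂≢0))
      (subst (¬_ ∘ S) (sym g₃∸a≡) (small-even∉S δ₃<a level₃≢0))
      (subst (¬_ ∘ S) (sym g₃∸g₂≡) (small-even∉S (≤-<-trans (m∸n≤m δ₃ δ₂) δ₃<a) level₃₂≢0))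
    where
    δ₂<a : δ₂ < a
    δ₂<a = Shift.δ<a shift₂
    δ₃<a : δ₃ < a
    δ₃<a = Shift.δ<a shift₃
    a<g₂ : a < g₂
    a<g₂ = subst (a <_) (sym g₂≡) (m<m+n a (<-≤-trans 0<δ₂ (m≤m+n δ₂ (δ₂ + 0))))
    g₂<g₃ : g₂ < g₃
    g₂<g₃ = subst₂ _<_ (sym g₂≡) (sym g₃≡) (+-monoʳ-< a (*-monoʳ-< 2 δ₂<δ₃))
    g₂∸a≡ : g₂ ∸ a ≡ 2 * δ₂
    g₂∸a≡ = trans (cong (_∸ a) g₂≡) (m+n∸m≡n a (2 * δ₂))
    g₃∸a≡ : g₃ ∸ a ≡ 2 * δ₃
    g₃∸a≡ = trans (cong (_∸ a) g₃≡) (m+n∸m≡n a (2 * δ₃))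
    g₃∸g₂≡ : g₃ ∸ g₂ ≡ 2 * (δ₃ ∸ δ₂)
    g₃∸g₂≡ = trans (cong₂ _∸_ g₃≡ g₂≡)
                   (trans ([m+n]∸[m+o]≡n∸o a (2 * δ₃) (2 * δ₂)) (sym (*-distribˡ-∸ 2 δ₃ δ₂)))

module FiveSevenEleven (k : ℕ) where

  -- level m is the least number of summands from {1, 3} adding up to m.
  level : ℕ → ℕ
  level 0                   = 0
  level 1                   = 1
  level 2                   = 2
  level (suc (suc (suc m))) = suc (level m)

  level-3q+r : ∀ q r → level (q * 3 + r) ≡ q + level r
  level-3q+r zero    r = refl
  level-3q+r (suc q) r = cong suc (level-3q+r q r)

  level-at : ∀ {m} q r → m ≡ q * 3 + r → level m ≡ q + level r
  level-at q r refl = level-3q+r q r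

  level-6k+2 : level (6 * k + 2) ≡ suc (2 * k + 1)
  level-6k+2 = trans (level-at (2 * k) 2 (solve (k ∷ []))) (+-suc (2 * k) 1)

  level-6k+3 : level (6 * k + 3) ≡ 2 * k + 1
  level-6k+3 = level-at (2 * k) 3 (solve (k ∷ []))

  level-6k+4 : level (6 * k + 4) ≡ suc (2 * k + 1)
  level-6k+4 = trans (level-at (2 * k) 4 (solve (k ∷ []))) (+-suc (2 * k) 1)

  level≤ : ∀ m → level m ≤ m
  level≤ 0                   = z≤n
  level≤ 1                   = ≤-refl
  level≤ 2                   = ≤-refl
  level≤ (suc (suc (suc m))) = s≤s (≤-trans (level≤ m) (m≤n+m m 2))

  level-step₁ : ∀ m → level (1 + m) ≤ suc (level m)
  level-step₁ 0                   = ≤-refl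
  level-step₁ 1                   = ≤-refl
  level-step₁ 2                   = s≤s z≤n
  level-step₁ (suc (suc (suc m))) = s≤s (level-step₁ m)

  level-step₃ : ∀ m → level (3 + m) ≤ suc (level m)
  level-step₃ _ = ≤-refl

  <a : ∀ {c} → c < 5 → c < 6 * k + 5
  <a c<5 = <-≤-trans c<5 (m≤n+m 5 (6 * k))

  6k+c<a : ∀ {c} → c < 5 → 6 * k + c < 6 * k + 5
  6k+c<a = +-monoʳ-< (6 * k)

  shift : ∀ {δ} → δ ≤ 3 → (∀ m → level (δ + m) ≤ suc (level m)) → Shift (6 * k + 5) level δ
  shift δ≤3 step = record
    { δ<a  = <a (s≤s (≤-trans δ≤3 (n≤1+n 3)))
    ; step = step
    ; wrap = λ m<a δ+m≡a+r →
        ≤-trans (level≤ _) (≤-trans (<⇒≤ (<-≤-trans (overflow< m<a δ+m≡a+r) δ≤3)) (m≤m+n 3 _))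
    }

  S : Subset
  S = ⟨ 6 * k + 5 ∷ 6 * k + 7 ∷ 6 * k + 11 ∷ [] ⟩ₗ

  g₂∈S : S (6 * k + 7)
  g₂∈S = ⟨⟩-generator (there (here refl))

  g₃∈S : S (6 * k + 11)
  g₃∈S = ⟨⟩-generator (there (there (here refl)))

  apery∈S : ∀ m → S (level m * (6 * k + 5) + 2 * m)
  apery∈S 0 = gen-zero
  apery∈S 1 = subst S g₂≡ g₂∈S
    where
    g₂≡ : 6 * k + 7 ≡ 1 * (6 * k + 5) + 2 * 1
    g₂≡ = solve (k ∷ [])
  apery∈S 2 = subst S 2g₂≡ (⟨⟩-+ g₂∈S g₂∈S)
    where
    2g₂≡ : 6 * k + 7 + (6 * k + 7) ≡ 2 * (6 * k + 5) + 2 * 2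
    2g₂≡ = solve (k ∷ [])
  apery∈S (suc (suc (suc m))) = subst S (regroup (level m)) (⟨⟩-+ g₃∈S (apery∈S m))
    where
    regroup : ∀ l → 6 * k + 11 + (l * (6 * k + 5) + 2 * m) ≡ suc l * (6 * k + 5) + 2 * (3 + m)
    regroup l = solve (k ∷ l ∷ m ∷ [])

  apery∈S-below : ∀ {m} → m < 6 * k + 5 → S (level m * (6 * k + 5) + 2 * m)
  apery∈S-below {m} _ = apery∈S m

  open Apéry (6 * k + 5) (3 * k + 2) (solve (k ∷ []))
             (6 * k + 7) (6 * k + 11) 1 3 (solve (k ∷ [])) (solve (k ∷ []))
             level refl (shift (s≤s z≤n) level-step₁) (shift ≤-refl level-step₃) apery∈S-below
    hiding (S)

  maximal⇒ : ∀ {m} → Maximal m → m ≡ 6 * k + 2 ⊎ m ≡ 6 * k + 4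
  maximal⇒ (_ , _ , below _ level[3+m]≤level[m]) = contradiction level[3+m]≤level[m] 1+n≰n
  maximal⇒ {m} (m<a , fits₁ , above r _ 3+m≡a+r _) = by-remainder r (overflow< m<a 3+m≡a+r) m≡6k+2+r
    where
    m≡6k+2+r : m ≡ 6 * k + 2 + r
    m≡6k+2+r = +-cancelˡ-≡ 3 m (6 * k + 2 + r) (trans 3+m≡a+r (solve (k ∷ r ∷ [])))

    6k+3-not-maximal : ¬ Fits (level (6 * k + 3)) (6 * k + 4)
    6k+3-not-maximal fits = 1+n≰n (subst₂ _≤_ level-6k+4 level-6k+3 (fits-below (6k+c<a ≤-refl) fits))

    by-remainder : ∀ r → r < 3 → m ≡ 6 * k + 2 + r → m ≡ 6 * k + 2 ⊎ m ≡ 6 * k + 4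
    by-remainder 0 _ m≡ = inj₁ (trans m≡ (+-identityʳ _))
    by-remainder 1 _ m≡ = ⊥-elim (6k+3-not-maximal (subst₂ Fits (cong level m≡6k+3) 1+m≡6k+4 fits₁))
      where
      m≡6k+3 : m ≡ 6 * k + 3
      m≡6k+3 = trans m≡ (+-assoc (6 * k) 2 1)
      1+m≡6k+4 : 1 + m ≡ 6 * k + 4
      1+m≡6k+4 = trans (cong suc m≡6k+3) (sym (+-suc (6 * k) 3))
    by-remainder 2 _ m≡ = inj₂ (trans m≡ (+-assoc (6 * k) 2 2))
    by-remainder (suc (suc (suc _))) (s≤s (s≤s (s≤s ()))) _

  maximal-6k+2 : Maximal (6 * k + 2)
  maximal-6k+2 = 6k+c<a (s<s (s<s z<s)) , fits₁ , above 0 (<a z<s) (solve (k ∷ [])) z≤n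
    where
    fits₁ : Fits (level (6 * k + 2)) (1 + (6 * k + 2))
    fits₁ = subst (Fits _) (+-suc (6 * k) 2)
                  (below (6k+c<a (s<s (s<s (s<s z<s))))
                         (subst₂ _≤_ (sym level-6k+3) (sym level-6k+2) (n≤1+n _)))

  maximal-6k+4 : Maximal (6 * k + 4)
  maximal-6k+4 = 6k+c<a ≤-refl , above 0 (<a z<s) (solve (k ∷ [])) z≤n
                              , above 2 (<a (s<s (s<s z<s))) (solve (k ∷ [])) (m≤m+n 2 _)

  e≡3 : EmbeddingDimensionIs S 3
  e≡3 = embeddingDimension z<s (s<s z<s) (λ ()) (λ ()) (λ ())

  t≡2 : TypeIs S 2
  t≡2 = type≡2 maximal-6k+2 maximal-6k+4 (λ eq → contradiction (+-cancelˡ-≡ (6 * k) 2 4 eq) λ ())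
               level-6k+2 level-6k+4 maximal⇒

module SevenElevenThirteen (k : ℕ) where

  -- level m is the least number of summands from {2, 3} adding up to m, except that m = 1 is only
  -- reached through a + 1 = 6k + 8 = 3 (2k + 2) + 2, with 2k + 3 summands and two extra copies of a.
  level : ℕ → ℕ
  level 0                               = 0
  level 1                               = 5 + 2 * k
  level 2                               = 1
  level 3                               = 1
  level 4                               = 2
  level (suc (suc (suc (suc (suc m))))) = suc (level (suc (suc m)))

  level-3q+r : ∀ q r → level (2 + (q * 3 + r)) ≡ q + level (2 + r)
  level-3q+r zero    r = refl
  level-3q+r (suc q) r = cong suc (level-3q+r q r)

  level-at : ∀ {m} q r → m ≡ 2 + (q * 3 + r) → level m ≡ q + level (2 + r)
  level-at q r refl = level-3q+r q r

  level-6k+4 : level (6 * k + 4) ≡ suc (2 * k + 1)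
  level-6k+4 = trans (level-at {6 * k + 4} (2 * k) 2 (solve (k ∷ []))) (+-suc (2 * k) 1)

  level-6k+5 : level (6 * k + 5) ≡ 2 * k + 2
  level-6k+5 = level-at {6 * k + 5} (2 * k) 3 (solve (k ∷ []))

  level-6k+6 : level (6 * k + 6) ≡ 2 * k + 2
  level-6k+6 = level-at {6 * k + 6} (2 * k) 4 (solve (k ∷ []))

  level-2+[6k+6] : level (2 + (6 * k + 6)) ≡ 2 * k + 2 + 1
  level-2+[6k+6] = level-at {2 + (6 * k + 6)} (2 * k + 2) 0 (solve (k ∷ []))

  level-step₂ : ∀ m → level (2 + m) ≤ suc (level m)
  level-step₂ 0                               = ≤-refl
  level-step₂ 1                               = s≤s z≤n
  level-step₂ 2                               = ≤-refl
  level-step₂ 3                               = ≤-refl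
  level-step₂ 4                               = n≤1+n 2
  level-step₂ (suc (suc (suc (suc (suc m))))) = s≤s (level-step₂ (suc (suc m)))

  level-step₃ : ∀ m → level (3 + m) ≤ suc (level m)
  level-step₃ 0             = ≤-refl
  level-step₃ 1             = s≤s (s≤s z≤n)
  level-step₃ (suc (suc m)) = ≤-refl

  2+m≡a+1⇒level≡2k+2 : ∀ {m} → 2 + m ≡ 6 * k + 7 + 1 → level m ≡ 2 * k + 2
  2+m≡a+1⇒level≡2k+2 {m} 2+m≡a+1 =
    trans (cong level (+-cancelˡ-≡ 2 m (6 * k + 6) (trans 2+m≡a+1 (solve (k ∷ []))))) level-6k+6

  3+m≡a+1⇒level≡2k+2 : ∀ {m} → 3 + m ≡ 6 * k + 7 + 1 → level m ≡ 2 * k + 2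
  3+m≡a+1⇒level≡2k+2 {m} 3+m≡a+1 =
    trans (cong level (+-cancelˡ-≡ 3 m (6 * k + 5) (trans 3+m≡a+1 (solve (k ∷ []))))) level-6k+5

  level[1]≰2+level : ∀ {m} → level m ≡ 2 * k + 2 → ¬ level 1 ≤ 2 + level m
  level[1]≰2+level {m} level≡ level[1]≤ =
    1+n≰n (subst (5 + 2 * k ≤_) 2+[2k+2]≡4+2k (subst ((5 + 2 * k ≤_) ∘ (2 +_)) level≡ level[1]≤))
    where
    2+[2k+2]≡4+2k : 2 + (2 * k + 2) ≡ 4 + 2 * k
    2+[2k+2]≡4+2k = solve (k ∷ [])

  <a : ∀ {c} → c < 7 → c < 6 * k + 7
  <a c<7 = <-≤-trans c<7 (m≤n+m 7 (6 * k))

  6k+c<a : ∀ {c} → c < 7 → 6 * k + c < 6 * k + 7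
  6k+c<a = +-monoʳ-< (6 * k)

  shift : ∀ {δ} → δ ≤ 3 → (∀ m → level (δ + m) ≤ suc (level m)) →
          (∀ {m} → δ + m ≡ 6 * k + 7 + 1 → level m ≡ 2 * k + 2) → Shift (6 * k + 7) level δ
  shift {δ} δ≤3 step δ+m≡a+1⇒level≡2k+2 = record
    { δ<a  = <a (s≤s (≤-trans δ≤3 (m≤m+n 3 3)))
    ; step = step
    ; wrap = wrap
    }
    where
    wrap : ∀ {m r} → m < 6 * k + 7 → δ + m ≡ 6 * k + 7 + r → level r ≤ 3 + level m
    wrap {r = 0} _ _ = z≤n
    wrap {m} {1} _ δ+m≡a+1 = ≤-reflexive (begin
      5 + 2 * k        ≡⟨ solve (k ∷ []) ⟩
      3 + (2 * k + 2)  ≡⟨ cong (3 +_) (sym (δ+m≡a+1⇒level≡2k+2 δ+m≡a+1)) ⟩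
      3 + level m      ∎)
      where open ≡-Reasoning
    wrap {r = 2} _ _ = s≤s z≤n
    wrap {r = suc (suc (suc _))} m<a δ+m≡a+r =
      contradiction (<-≤-trans (overflow< m<a δ+m≡a+r) δ≤3) λ { (s≤s (s≤s (s≤s ()))) }

  S : Subset
  S = ⟨ 6 * k + 7 ∷ 6 * k + 11 ∷ 6 * k + 13 ∷ [] ⟩ₗ

  g₂∈S : S (6 * k + 11)
  g₂∈S = ⟨⟩-generator (there (here refl))

  g₃∈S : S (6 * k + 13)
  g₃∈S = ⟨⟩-generator (there (there (here refl)))

  apery∈S-≥2 : ∀ m → S (level (2 + m) * (6 * k + 7) + 2 * (2 + m))
  apery∈S-≥2 0 = subst S g₂≡ g₂∈S
    where
    g₂≡ : 6 * k + 11 ≡ 1 * (6 * k + 7) + 2 * 2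
    g₂≡ = solve (k ∷ [])
  apery∈S-≥2 1 = subst S g₃≡ g₃∈S
    where
    g₃≡ : 6 * k + 13 ≡ 1 * (6 * k + 7) + 2 * 3
    g₃≡ = solve (k ∷ [])
  apery∈S-≥2 2 = subst S 2g₂≡ (⟨⟩-+ g₂∈S g₂∈S)
    where
    2g₂≡ : 6 * k + 11 + (6 * k + 11) ≡ 2 * (6 * k + 7) + 2 * 4
    2g₂≡ = solve (k ∷ [])
  apery∈S-≥2 (suc (suc (suc m))) = subst S (regroup (level (2 + m))) (⟨⟩-+ g₃∈S (apery∈S-≥2 m))
    where
    regroup : ∀ l → 6 * k + 13 + (l * (6 * k + 7) + 2 * (2 + m)) ≡ suc l * (6 * k + 7) + 2 * (5 + m)
    regroup l = solve (k ∷ l ∷ m ∷ [])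

  apery∈S : ∀ m → S (level m * (6 * k + 7) + 2 * m)
  apery∈S 0             = gen-zero
  apery∈S 1             = subst S a+1≡ (apery∈S-≥2 (6 * k + 6))
    where
    open ≡-Reasoning
    a+1≡ : level (2 + (6 * k + 6)) * (6 * k + 7) + 2 * (2 + (6 * k + 6)) ≡ (5 + 2 * k) * (6 * k + 7) + 2 * 1
    a+1≡ = begin
      level (2 + (6 * k + 6)) * (6 * k + 7) + 2 * (2 + (6 * k + 6))
        ≡⟨ cong (λ l → l * (6 * k + 7) + 2 * (2 + (6 * k + 6))) level-2+[6k+6] ⟩
      (2 * k + 2 + 1) * (6 * k + 7) + 2 * (2 + (6 * k + 6))
        ≡⟨ solve (k ∷ []) ⟩
      (5 + 2 * k) * (6 * k + 7) + 2 * 1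
        ∎
  apery∈S (suc (suc m)) = apery∈S-≥2 m

  apery∈S-below : ∀ {m} → m < 6 * k + 7 → S (level m * (6 * k + 7) + 2 * m)
  apery∈S-below {m} _ = apery∈S m

  open Apéry (6 * k + 7) (3 * k + 3) (solve (k ∷ []))
             (6 * k + 11) (6 * k + 13) 2 3 (solve (k ∷ [])) (solve (k ∷ []))
             level refl (shift (s≤s (s≤s z≤n)) level-step₂ 2+m≡a+1⇒level≡2k+2)
             (shift ≤-refl level-step₃ 3+m≡a+1⇒level≡2k+2) apery∈S-below
    hiding (S)

  maximal⇒ : ∀ {m} → Maximal m → m ≡ 1 ⊎ m ≡ 6 * k + 4
  maximal⇒ {0}           (_ , _ , below _ ())
  maximal⇒ {1}           _ = inj₁ refl
  maximal⇒ {suc (suc m)} (_ , _ , below _ level[5+m]≤level[2+m]) = contradiction level[5+m]≤level[2+m] 1+n≰n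
  maximal⇒ {m} (m<a , fits₂ , above r _ 3+m≡a+r level[r]≤) =
    by-remainder r (overflow< m<a 3+m≡a+r) m≡6k+4+r level[r]≤
    where
    m≡6k+4+r : m ≡ 6 * k + 4 + r
    m≡6k+4+r = +-cancelˡ-≡ 3 m (6 * k + 4 + r) (trans 3+m≡a+r (solve (k ∷ r ∷ [])))

    by-remainder : ∀ r → r < 3 → m ≡ 6 * k + 4 + r → level r ≤ 2 + level m → m ≡ 1 ⊎ m ≡ 6 * k + 4
    by-remainder 0 _ m≡ _ = inj₂ (trans m≡ (+-identityʳ _))
    by-remainder 1 _ m≡ level[1]≤ =
      contradiction level[1]≤
                    (level[1]≰2+level {m} (trans (cong level (trans m≡ (+-assoc (6 * k) 4 1))) level-6k+5))
    by-remainder 2 _ m≡ _ =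
      contradiction (fits-above (subst (Fits (level m)) 2+m≡a+1 fits₂))
                    (level[1]≰2+level {m} (trans (cong level m≡6k+6) level-6k+6))
      where
      m≡6k+6 : m ≡ 6 * k + 6
      m≡6k+6 = trans m≡ (+-assoc (6 * k) 4 2)
      2+m≡a+1 : 2 + m ≡ 6 * k + 7 + 1
      2+m≡a+1 = trans (cong (2 +_) m≡6k+6) (solve (k ∷ []))
    by-remainder (suc (suc (suc _))) (s≤s (s≤s (s≤s ()))) _ _

  maximal-1 : Maximal 1
  maximal-1 = <a (s<s z<s) , below (<a (s<s (s<s (s<s z<s)))) (s≤s z≤n)
                           , below (<a (s<s (s<s (s<s (s<s z<s))))) (s≤s (s≤s z≤n))

  maximal-6k+4 : Maximal (6 * k + 4)
  maximal-6k+4 = 6k+c<a (s<s (s<s (s<s (s<s z<s)))) , fits₂ , above 0 (<a z<s) (solve (k ∷ [])) z≤n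
    where
    6k+6≡ : 6 * k + 6 ≡ 2 + (6 * k + 4)
    6k+6≡ = solve (k ∷ [])
    fits₂ : Fits (level (6 * k + 4)) (2 + (6 * k + 4))
    fits₂ = subst (Fits _) 6k+6≡
                  (below (6k+c<a ≤-refl)
                         (≤-reflexive (trans level-6k+6 (trans (+-suc (2 * k) 1) (sym level-6k+4)))))

  e≡3 : EmbeddingDimensionIs S 3
  e≡3 = embeddingDimension z<s (s<s (s<s z<s)) (λ ()) (λ ()) (λ ())

  t≡2 : TypeIs S 2
  t≡2 = type≡2 maximal-1 maximal-6k+4 (<⇒≢ (<-≤-trans (s<s z<s) (m≤n+m 4 (6 * k)))) refl level-6k+4 maximal⇒

proposition6 : (k : ℕ) → (S : Subset) →
    (S ≡ ⟨ 6 * k + 5 ∷ 6 * k + 7 ∷ 6 * k + 11 ∷ [] ⟩ₗ ⊎ S ≡ ⟨ 6 * k + 7 ∷ 6 * k + 11 ∷ 6 * k + 13 ∷ [] ⟩ₗ) →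
    EmbeddingDimensionIs S 3 × TypeIs S 2
proposition6 k S (inj₁ refl) = FiveSevenEleven.e≡3 k , FiveSevenEleven.t≡2 k
proposition6 k S (inj₂ refl) = SevenElevenThirteen.e≡3 k , SevenElevenThirteen.t≡2 k
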